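{- For a subpermutation $s$ of length $n$, we have $\delta(M^s) = \mathcal{O}(n)$.
   Context: A sequence $s[0],\dots,s[n-1]$ is a subpermutation if each $s[i]\in\{0,\dots,n-1\}\cup\{\star\}$ (where $\star$ is a placeholder symbol) and the subsequence $s^*$ of non-placeholder elements is a permutation of $\{0,\dots,|s^*|-1\}$. The alignment graph $G^s$ is the edge-weighted directed graph with vertex set $\{0,\dots,n\}\times\{0,\dots,|s^*|\}$ and edges: $(x,y)\to(x,y+1)$ of weight $0$ for $y<|s^*|$; $(x,y)\to(x+1,y)$ of weight $0$ for $x<n$; $(i,s[i])\to(i+1,s[i]+1)$ of weight $1$ for each $i$ with $s[i]\ne\star$; and $(x,y)\to(x-1,y)$ of weight $-2$ for $x>0$. $M^s$ is the $(n+1)\times(n+1)$ matrix with $M^s_{i,j}$ the length of the longest path in $G^s$ from $(i,0)$ to $(j,|s^*|)$. For a matrix $M$, $M^{\square}_{i,j}=M_{i,j+1}+M_{i+1,j}-M_{i,j}-M_{i+1,j+1}$ and $\delta(M)$ is the number of pairs $(i,j)$ with $M^{\square}_{i,j}\ne0$. -}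

module Defs where

open import Data.Nat as ℕ using (ℕ; zero; suc; _<_; _≤_)
open import Data.Integer as ℤ using (ℤ; +_; -[1+_])
open import Data.Integer.Properties using () renaming (_≟_ to _≟ℤ_)
open import Data.Fin using (Fin; toℕ; inject₁) renaming (suc to fsuc)
open import Data.Maybe using (Maybe; just; nothing)
open import Data.Vec as V using (Vec; lookup)
open import Data.List using (List; []; _∷_; length; filter; map; upTo; allFin)
open import Data.Nat.ListAction using (sum)
open import Data.List.Relation.Binary.Permutation.Propositional using (_↭_)
open import Data.List.Relation.Unary.All using (All)
open import Data.Product using (Σ; _×_; _,_)
open import Relation.Binary.PropositionalEquality using (_≡_)
open import Relation.Nullary using (¬?)

-- s* : the subsequence of non-placeholder entries (placeholder ⋆ = nothing)
justs : ∀ {n} → Vec (Maybe ℕ) n → List ℕ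
justs V.[] = []
justs (just a V.∷ s) = a ∷ justs s
justs (nothing V.∷ s) = justs s

IsSubperm : ∀ {n} → Vec (Maybe ℕ) n → Set
IsSubperm {n} s =
  All (λ a → a < n) (justs s) × (justs s ↭ upTo (length (justs s)))

len* : ∀ {n} → Vec (Maybe ℕ) n → ℕ
len* s = length (justs s)

-- Edges of the alignment graph G^s, vertices (x , y) with x ≤ n, y ≤ |s*|;
-- Edge s x y x' y' w : there is an edge (x,y) → (x',y') of weight w.
data Edge {n : ℕ} (s : Vec (Maybe ℕ) n) : ℕ → ℕ → ℕ → ℕ → ℤ → Set where
  up    : ∀ {x y} → x ≤ n → y < len* s → Edge s x y x (suc y) (+ 0)
  right : ∀ {x y} → x < n → y ≤ len* s → Edge s x y (suc x) y (+ 0)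
  diag  : ∀ (i : Fin n) {k} → lookup s i ≡ just k →
          Edge s (toℕ i) k (suc (toℕ i)) (suc k) (+ 1)
  left  : ∀ {x y} → suc x ≤ n → y ≤ len* s → Edge s (suc x) y x y (-[1+ 1 ])

data Walk {n : ℕ} (s : Vec (Maybe ℕ) n) : ℕ → ℕ → ℕ → ℕ → ℤ → Set where
  stop : ∀ {x y} → Walk s x y x y (+ 0)
  step : ∀ {x y x' y' x'' y'' w w'} → Edge s x y x' y' w →
         Walk s x' y' x'' y'' w' → Walk s x y x'' y'' (w ℤ.+ w')

IsLongest : ∀ {n} → Vec (Maybe ℕ) n → ℕ → ℕ → ℕ → ℕ → ℤ → Set
IsLongest s x y x' y' v =
  Walk s x y x' y' v × (∀ w → Walk s x y x' y' w → w ℤ.≤ v)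

IsAlignMatrix : ∀ {n} → Vec (Maybe ℕ) n → (Fin (suc n) → Fin (suc n) → ℤ) → Set
IsAlignMatrix s M = ∀ i j → IsLongest s (toℕ i) 0 (toℕ j) (len* s) (M i j)

box : ∀ {n} → (Fin (suc n) → Fin (suc n) → ℤ) → Fin n → Fin n → ℤ
box M i j = M (inject₁ i) (fsuc j) ℤ.+ M (fsuc i) (inject₁ j)
            ℤ.- M (inject₁ i) (inject₁ j) ℤ.- M (fsuc i) (fsuc j)

δ : ∀ {n} → (Fin (suc n) → Fin (suc n) → ℤ) → ℕ
δ {n} M = sum (map (λ i → length (filter (λ j → ¬? (box M i j ≟ℤ + 0)) (allFin n))) (allFin n))

-- Two walks in G^s that cross (start in order a ≤ b, end in order d ≤ c) share a vertex;
-- exchanging their tails there gives M(i,j+1) + M(i+1,j) ≤ M(i,j) + M(i+1,j+1), i.e. every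
-- entry of M^□ is ≤ 0. So δ(M) ≤ -Σ M^□, and this sum telescopes to the corner difference
-- (M(n,n) - M(n,0)) - (M(0,n) - M(0,0)) ≤ |s*| + 2n + |s*| ≤ 4n.
module Submission where

open import Defs
open import Data.Nat using (ℕ; suc; _≤_; _*_)
open import Data.Integer using (ℤ)
open import Data.Fin using (Fin)
open import Data.Maybe using (Maybe)
open import Data.Vec using (Vec)
open import Data.Product using (∃-syntax)

open import Data.Empty using (⊥-elim)
open import Data.Fin using (zero; suc; toℕ; inject₁; fromℕ)
open import Data.Fin.Patterns using (0F; 1F)
open import Data.Fin.Properties using (toℕ-inject₁; toℕ≤pred[n]; toℕ-fromℕ)
open import Data.Integer as ℤ using (+_; -[1+_]; +0; +[1+_]; _+_; _-_; -_; 0ℤ; 1ℤ; +≤+)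
open import Data.Integer.Properties as ℤ
  using ( +-identityˡ; +-identityʳ; +-assoc; +-comm; +-inverseʳ; +-minus-telescope; neg-distrib-+
        ; +-mono-≤; +-monoˡ-≤; +-monoʳ-≤; neg-mono-≤; i≤j⇒i-j≤0; pos-*)
open import Data.Integer.Tactic.RingSolver using (solve-∀)
open import Algebra.Properties.Monoid.Sum ℤ.+-0-monoid using (sum-syntax; sum-cong-≗) renaming (sum to ∑)
open import Data.List using (length; filter; map; tabulate)
open import Data.Maybe using (just; nothing)
open import Data.Nat as ℕ using (zero; _<_; _≤?_; z≤n; s≤s)
open import Data.Nat.ListAction using (sum)
open import Data.Nat.Properties
  using ( _≟_; ≤-refl; ≤-reflexive; ≤-trans; ≤-antisym; ≤-pred; <⇒≤; ≤∧≢⇒<; ≰⇒>; <⇒≱; <-irrefl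
        ; n≤1+n; m≤n⇒m≤1+n; m≤n+m; +-suc; m∸n+n≡m)
open import Data.Product using (_×_; _,_; proj₁; proj₂)
open import Data.Sum using (_⊎_; inj₁; inj₂)
import Data.Vec as V
open import Function using (_∘_; id)
open import Relation.Binary.PropositionalEquality
  using (_≡_; _≢_; refl; sym; trans; cong; subst; module ≡-Reasoning)
open import Relation.Nullary using (yes; no; ¬?)

private variable
  a a' b c c' d n p p' q u v x y y' Y Y' : ℕ
  w w' h h' r r' e e' : ℤ

Between : ℕ → ℕ → ℕ → Set
Between x a c = (a ≤ x × x ≤ c) ⊎ (c ≤ x × x ≤ a)

between-suc : x ≢ a → Between x a c → Between x (suc a) c
between-suc x≢a (inj₁ (a≤x , x≤c)) = inj₁ (≤∧≢⇒< a≤x (x≢a ∘ sym) , x≤c)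
between-suc x≢a (inj₂ (c≤x , x≤a)) = inj₂ (c≤x , m≤n⇒m≤1+n x≤a)

between-pred : x ≢ suc a → Between x (suc a) c → Between x a c
between-pred x≢a (inj₁ (a<x , x≤c)) = inj₁ (≤-trans (n≤1+n _) a<x , x≤c)
between-pred x≢a (inj₂ (c≤x , x≤a)) = inj₂ (c≤x , ≤-pred (≤∧≢⇒< x≤a x≢a))

inject₁≤suc : (i : Fin n) → toℕ (inject₁ i) ≤ toℕ (suc i)
inject₁≤suc i = m≤n⇒m≤1+n (≤-reflexive (toℕ-inject₁ i))

len*≤ : (s : Vec (Maybe ℕ) n) → len* s ≤ n
len*≤ V.[]            = z≤n
len*≤ (just _ V.∷ s)  = s≤s (len*≤ s)
len*≤ (nothing V.∷ s) = m≤n⇒m≤1+n (len*≤ s)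

module AlignmentGraph {n : ℕ} (s : Vec (Maybe ℕ) n) where

  infixr 5 _++_ _◅_ _◅◅_ _◅ᴸ_
  infixl 5 _▻▻_

  _++_ : Walk s a y b y' w → Walk s b y' c Y w' → Walk s a y c Y (w + w')
  stop ++ Q = subst (Walk s _ _ _ _) (sym (+-identityˡ _)) Q
  step {w = e} {w' = w} E P ++ Q = subst (Walk s _ _ _ _) (sym (+-assoc e w _)) (step E (P ++ Q))

  row-nondecreasing : Walk s a y c Y w → y ≤ Y
  row-nondecreasing stop = ≤-refl
  row-nondecreasing (step (up _ _) P) = ≤-trans (n≤1+n _) (row-nondecreasing P)
  row-nondecreasing (step (right _ _) P) = row-nondecreasing P
  row-nondecreasing (step (diag _ _) P) = ≤-trans (n≤1+n _) (row-nondecreasing P)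
  row-nondecreasing (step (left _ _) P) = row-nondecreasing P

  record Via (u v a y c Y : ℕ) (w : ℤ) : Set where
    constructor via
    field
      {w₁ w₂} : ℤ
      before : Walk s a y u v w₁
      after  : Walk s u v c Y w₂
      weight : w ≡ w₁ + w₂

  via-start : Walk s a y c Y w → Via a y a y c Y w
  via-start P = via stop P (sym (+-identityˡ _))

  via-end : Walk s a y c Y w → Via c Y a y c Y w
  via-end P = via P stop (sym (+-identityʳ _))

  _◅_ : Edge s a y a' y' e → Via u v a' y' c Y w → Via u v a y c Y (e + w)
  _◅_ {e = e} E (via {w₁} B A refl) = via (step E B) A (sym (+-assoc e w₁ _))

  _◅◅_ : Walk s a y a' y' h → Via u v a' y' c Y w → Via u v a y c Y (h + w)
  _◅◅_ {h = h} P (via {w₁} B A refl) = via (P ++ B) A (sym (+-assoc h w₁ _))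

  _▻▻_ : Via u v a y c Y w → Walk s c Y c' Y' r → Via u v a y c' Y' (w + r)
  via {w₁} {w₂} B A refl ▻▻ R = via B (A ++ R) (+-assoc w₁ w₂ _)

  cut-row : ∀ x → Between x a c → Walk s a y c y w → Via x y a y c y w
  cut-row {a = a} x x∈ P with x ≟ a
  ... | yes refl = via-start P
  cut-row x (inj₁ (a≤x , x≤a)) stop | no x≢a = ⊥-elim (x≢a (≤-antisym x≤a a≤x))
  cut-row x (inj₂ (a≤x , x≤a)) stop | no x≢a = ⊥-elim (x≢a (≤-antisym x≤a a≤x))
  cut-row x x∈ (step (up _ _) P) | no _ = ⊥-elim (<-irrefl refl (row-nondecreasing P))
  cut-row x x∈ (step (diag _ _) P) | no _ = ⊥-elim (<-irrefl refl (row-nondecreasing P))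
  cut-row x x∈ (step E@(right _ _) P) | no x≢a = E ◅ cut-row x (between-suc x≢a x∈) P
  cut-row x x∈ (step E@(left _ _) P) | no x≢a = E ◅ cut-row x (between-pred x≢a x∈) P

  record LeavesRow (a y c Y : ℕ) (w : ℤ) : Set where
    constructor leaves
    field
      {exit entry} : ℕ
      {w-along w-rise w-rest} : ℤ
      along  : Walk s a y exit y w-along
      rise   : Edge s exit y entry (suc y) w-rise
      rest   : Walk s entry (suc y) c Y w-rest
      weight : w ≡ w-along + (w-rise + w-rest)

  _◅ᴸ_ : Edge s a y a' y e → LeavesRow a' y c Y w → LeavesRow a y c Y (e + w)
  _◅ᴸ_ {e = e} E (leaves {w-along = h} A U R refl) = leaves (step E A) U R (sym (+-assoc e h _))

  leave-row : y < Y → Walk s a y c Y w → LeavesRow a y c Y w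
  leave-row y<y stop = ⊥-elim (<-irrefl refl y<y)
  leave-row _ (step E@(up _ _) R) = leaves stop E R (sym (+-identityˡ _))
  leave-row _ (step E@(diag _ _) R) = leaves stop E R (sym (+-identityˡ _))
  leave-row y<Y (step E@(right _ _) R) = E ◅ᴸ leave-row y<Y R
  leave-row y<Y (step E@(left _ _) R) = E ◅ᴸ leave-row y<Y R

  rise-bounds : Edge s p y p' (suc y) e → p ≤ p' × p' ≤ suc p
  rise-bounds (up _ _) = ≤-refl , n≤1+n _
  rise-bounds (diag _ _) = n≤1+n _ , ≤-refl

  record Meet (a b y c d Y : ℕ) (w w' : ℤ) : Set where
    constructor meet
    field
      {column row} : ℕ
      first  : Via column row a y c Y w
      second : Via column row b y d Y w'

  meet-◅ : Edge s a y a' y' e → Edge s b y q y' e' → Meet a' q y' c d Y w w' →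
           Meet a b y c d Y (e + w) (e' + w')
  meet-◅ E E' (meet V V') = meet (E ◅ V) (E' ◅ V')

  meet-◅◅ : Walk s a y a' y' h → Walk s b y q y' h' → Meet a' q y' c d Y w w' →
            Meet a b y c d Y (h + w) (h' + w')
  meet-◅◅ P P' (meet V V') = meet (P ◅◅ V) (P' ◅◅ V')

  meet-▻▻ : Meet a b y p q y' w w' → Walk s p y' c Y r → Walk s q y' d Y r' →
            Meet a b y c d Y (w + r) (w' + r')
  meet-▻▻ (meet V V') R R' = meet (V ▻▻ R) (V' ▻▻ R')

  meet-in-row : a ≤ b → Walk s a y p y w → Walk s b y q y w' → Meet a b y p q y w w' ⊎ p < q
  meet-in-row {b = b} {p = p} {q = q} a≤b P Q with b ≤? p | q ≤? p
  ... | yes b≤p | _       = inj₁ (meet (cut-row b (inj₁ (a≤b , b≤p)) P) (via-start Q))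
  ... | no b≰p  | yes q≤p = inj₁ (meet (via-end P) (cut-row p (inj₂ (q≤p , <⇒≤ (≰⇒> b≰p))) Q))
  ... | no _    | no q≰p  = inj₂ (≰⇒> q≰p)

  -- Row by row: either the two walks meet while crossing row y, or the first one leaves
  -- the row strictly left of the second, so the order a ≤ b persists one row higher.
  walks-meet : a ≤ b → d ≤ c → Walk s a y c Y w → Walk s b y d Y w' → Meet a b y c d Y w w'
  walks-meet a≤b d≤c P = rows-left _ (m∸n+n≡m (row-nondecreasing P)) a≤b d≤c P
    where
    rows-left : ∀ k → k ℕ.+ y ≡ Y → a ≤ b → d ≤ c →
                Walk s a y c Y w → Walk s b y d Y w' → Meet a b y c d Y w w'
    rows-left zero refl a≤b d≤c P Q with meet-in-row a≤b P Q
    ... | inj₁ m   = m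
    ... | inj₂ c<d = ⊥-elim (<⇒≱ c<d d≤c)
    rows-left {y = y} (suc k) refl a≤b d≤c P Q
      with leaves {entry = p'} A E R refl ← leave-row (s≤s (m≤n+m y k)) P
         | leaves {entry = q'} A' E' R' refl ← leave-row (s≤s (m≤n+m y k)) Q
      with meet-in-row a≤b A A'
    ... | inj₁ m   = meet-▻▻ m (step E R) (step E' R')
    ... | inj₂ p<q = meet-◅◅ A A' (meet-◅ E E' (rows-left k (+-suc k y) entries d≤c R R'))
      where
      entries : p' ≤ q'
      entries = ≤-trans (proj₂ (rise-bounds E)) (≤-trans p<q (proj₁ (rise-bounds E')))

  longest-monge : a ≤ b → d ≤ c →
                  IsLongest s a y c Y w → IsLongest s b y d Y w' →
                  IsLongest s a y d Y h → IsLongest s b y c Y h' → w + w' ℤ.≤ h + h'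
  longest-monge {h = h} {h' = h'} a≤b d≤c (P , _) (Q , _) (_ , ad-longest) (_ , bc-longest)
    with walks-meet a≤b d≤c P Q
  ... | meet (via {p₁} {p₂} P₁ P₂ refl) (via {q₁} {q₂} Q₁ Q₂ refl) = begin
    (p₁ + p₂) + (q₁ + q₂) ≡⟨ exchange p₁ p₂ q₁ q₂ ⟩
    (p₁ + q₂) + (q₁ + p₂) ≤⟨ +-mono-≤ (ad-longest _ (P₁ ++ Q₂)) (bc-longest _ (Q₁ ++ P₂)) ⟩
    h + h'                ∎
    where
    open ℤ.≤-Reasoning
    exchange : ∀ i j k l → (i + j) + (k + l) ≡ (i + l) + (k + j)
    exchange = solve-∀

  edge-weight≤rise : Edge s a y c Y e → e + + y ℤ.≤ + Y
  edge-weight≤rise {y = y} (up _ _)   = +≤+ (n≤1+n y)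
  edge-weight≤rise          (right _ _) = ℤ.≤-refl
  edge-weight≤rise          (diag _ _)  = ℤ.≤-refl
  edge-weight≤rise {y = y} (left _ _)  = +-monoˡ-≤ (+ y) ℤ.-≤+

  walk-weight≤rise : Walk s a y c Y w → w + + y ℤ.≤ + Y
  walk-weight≤rise stop = ℤ.≤-refl
  walk-weight≤rise {y = y} {Y = Y} (step {w = e} {w' = w} E P) = begin
    (e + w) + + y ≡⟨ rearrange e w (+ y) ⟩
    w + (e + + y) ≤⟨ +-monoʳ-≤ w (edge-weight≤rise E) ⟩
    w + _         ≤⟨ walk-weight≤rise P ⟩
    + Y           ∎
    where
    open ℤ.≤-Reasoning
    rearrange : ∀ i j k → (i + j) + k ≡ j + (i + k)
    rearrange = solve-∀

  rightward : x ≤ n → Walk s 0 0 x 0 (+ 0)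
  rightward {zero}  _   = stop
  rightward {suc x} x<n = rightward (<⇒≤ x<n) ++ step (right x<n z≤n) stop

  leftward : x ≤ n → Walk s x 0 0 0 (-[1+ 1 ] ℤ.* + x)
  leftward {zero}  _   = stop
  leftward {suc x} x<n =
    subst (Walk s _ _ _ _) (sym (ℤ.*-suc -[1+ 1 ] (+ x))) (step (left x<n z≤n) (leftward (<⇒≤ x<n)))

  upward : x ≤ n → Y ≤ len* s → Walk s x 0 x Y (+ 0)
  upward {Y = zero}  _   _   = stop
  upward {Y = suc Y} x≤n Y<m = upward x≤n (<⇒≤ Y<m) ++ step (up x≤n Y<m) stop

∑-telescope : ∀ {k} (g : Fin (suc k) → ℤ) → ∑[ j < k ] (g (suc j) - g (inject₁ j)) ≡ g (fromℕ k) - g zero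
∑-telescope {zero}  g = sym (+-inverseʳ (g zero))
∑-telescope {suc k} g = begin
  (g 1F - g 0F) + ∑[ j < k ] (g (suc (suc j)) - g (suc (inject₁ j)))
    ≡⟨ cong (λ t → (g 1F - g 0F) + t) (∑-telescope (g ∘ suc)) ⟩
  (g 1F - g 0F) + (g (fromℕ (suc k)) - g 1F)
    ≡⟨ +-comm (g 1F - g 0F) _ ⟩
  (g (fromℕ (suc k)) - g 1F) + (g 1F - g 0F)
    ≡⟨ +-minus-telescope (g (fromℕ (suc k))) (g 1F) (g 0F) ⟩
  g (fromℕ (suc k)) - g 0F
    ∎
  where open ≡-Reasoning

i≤0∧i≢0⇒1≤-i : ∀ {i} → i ℤ.≤ 0ℤ → i ≢ 0ℤ → 1ℤ ℤ.≤ - i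
i≤0∧i≢0⇒1≤-i {+0}        _        i≢0 = ⊥-elim (i≢0 refl)
i≤0∧i≢0⇒1≤-i {+[1+ _ ]}  (+≤+ ()) _
i≤0∧i≢0⇒1≤-i { -[1+ _ ]} _        _   = +≤+ (s≤s z≤n)

nonzeros≤∑-neg : ∀ {A : Set} {k} (f : A → ℤ) (g : Fin k → A) → (∀ i → f (g i) ℤ.≤ 0ℤ) →
                 + length (filter (λ x → ¬? (f x ℤ.≟ 0ℤ)) (tabulate g)) ℤ.≤ ∑[ i < k ] (- f (g i))
nonzeros≤∑-neg {k = zero}  f g f≤0 = ℤ.≤-refl
nonzeros≤∑-neg {k = suc k} f g f≤0 with f (g zero) ℤ.≟ 0ℤ
... | no f₀≢0  = +-mono-≤ (i≤0∧i≢0⇒1≤-i (f≤0 zero) f₀≢0) (nonzeros≤∑-neg f (g ∘ suc) (f≤0 ∘ suc))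
... | yes f₀≡0 = begin
  + length (filter (λ x → ¬? (f x ℤ.≟ 0ℤ)) (tabulate (g ∘ suc)))
    ≤⟨ nonzeros≤∑-neg f (g ∘ suc) (f≤0 ∘ suc) ⟩
  rest            ≡⟨ sym (+-identityˡ rest) ⟩
  - 0ℤ + rest     ≡⟨ cong (λ t → - t + rest) (sym f₀≡0) ⟩
  - f (g 0F) + rest ∎
  where
  open ℤ.≤-Reasoning
  rest : ℤ
  rest = ∑[ i < k ] (- f (g (suc i)))

+sum≤∑ : ∀ {A : Set} {k} (c : A → ℕ) (g : Fin k → A) (f : Fin k → ℤ) → (∀ i → + c (g i) ℤ.≤ f i) →
         + sum (map c (tabulate g)) ℤ.≤ ∑ f
+sum≤∑ {k = zero}  c g f c≤f = ℤ.≤-refl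
+sum≤∑ {k = suc k} c g f c≤f = +-mono-≤ (c≤f zero) (+sum≤∑ c (g ∘ suc) (f ∘ suc) (c≤f ∘ suc))

δ≤∑∑-neg-box : (M : Fin (suc n) → Fin (suc n) → ℤ) → (∀ i j → box M i j ℤ.≤ 0ℤ) →
               + δ M ℤ.≤ ∑[ i < n ] ∑[ j < n ] (- box M i j)
δ≤∑∑-neg-box M box≤0 = +sum≤∑ _ id _ (λ i → nonzeros≤∑-neg (box M i) id (box≤0 i))

∑∑-neg-box : (M : Fin (suc n) → Fin (suc n) → ℤ) →
             ∑[ i < n ] ∑[ j < n ] (- box M i j) ≡
             (M (fromℕ n) (fromℕ n) - M (fromℕ n) zero) - (M zero (fromℕ n) - M zero zero)
∑∑-neg-box {n} M = begin
  ∑[ i < n ] ∑[ j < n ] (- box M i j)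
    ≡⟨ sum-cong-≗ (λ i → trans (sum-cong-≗ (neg-box≡Δgap i)) (∑-telescope (gap i))) ⟩
  ∑[ i < n ] (gap i (fromℕ n) - gap i zero)
    ≡⟨ sum-cong-≗ Δgap≡Δspan ⟩
  ∑[ i < n ] (span (suc i) - span (inject₁ i))
    ≡⟨ ∑-telescope span ⟩
  span (fromℕ n) - span zero
    ∎
  where
  open ≡-Reasoning
  gap : Fin n → Fin (suc n) → ℤ
  gap i j = M (suc i) j - M (inject₁ i) j
  span : Fin (suc n) → ℤ
  span i = M i (fromℕ n) - M i zero
  neg-box≡Δgap : ∀ i j → - box M i j ≡ gap i (suc j) - gap i (inject₁ j)
  neg-box≡Δgap i j = shape (M (inject₁ i) (suc j)) (M (suc i) (inject₁ j)) (M (inject₁ i) (inject₁ j)) (M (suc i) (suc j))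
    where
    shape : ∀ a b c d → - (a + b - c - d) ≡ (d - a) - (b - c)
    shape = solve-∀
  Δgap≡Δspan : ∀ i → gap i (fromℕ n) - gap i zero ≡ span (suc i) - span (inject₁ i)
  Δgap≡Δspan i = shape (M (suc i) (fromℕ n)) (M (inject₁ i) (fromℕ n)) (M (suc i) zero) (M (inject₁ i) zero)
    where
    shape : ∀ a b c d → (a - b) - (c - d) ≡ (a - c) - (b - d)
    shape = solve-∀

corner-difference≤ : ∀ {A B C D : ℤ} → A ℤ.≤ + n → D ℤ.≤ + n → 0ℤ ℤ.≤ C → -[1+ 1 ] ℤ.* + n ℤ.≤ B →
                     (A - B) - (C - D) ℤ.≤ + (4 * n)
corner-difference≤ {n} {A} {B} {C} {D} A≤n D≤n 0≤C -2n≤B = begin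
  (A - B) - (C - D)
    ≤⟨ +-mono-≤ (+-mono-≤ A≤n (neg-mono-≤ -2n≤B)) (neg-mono-≤ (+-mono-≤ 0≤C (neg-mono-≤ D≤n))) ⟩
  (+ n - -[1+ 1 ] ℤ.* + n) - (0ℤ - + n) ≡⟨ four-times (+ n) ⟩
  + 4 ℤ.* + n                           ≡⟨ sym (pos-* 4 n) ⟩
  + (4 * n)                             ∎
  where
  open ℤ.≤-Reasoning
  four-times : ∀ x → (x - -[1+ 1 ] ℤ.* x) - (0ℤ - x) ≡ + 4 ℤ.* x
  four-times = solve-∀

module _ {n : ℕ} {s : Vec (Maybe ℕ) n} {M : Fin (suc n) → Fin (suc n) → ℤ}
         (isM : IsAlignMatrix s M) where

  open AlignmentGraph s

  box-nonpositive : ∀ i j → box M i j ℤ.≤ 0ℤ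
  box-nonpositive i j = begin
    A + B - C - D     ≡⟨ +-assoc (A + B) (- C) (- D) ⟩
    A + B + (- C - D) ≡⟨ cong (λ z → A + B + z) (sym (neg-distrib-+ C D)) ⟩
    (A + B) - (C + D) ≤⟨ i≤j⇒i-j≤0 (longest-monge (inject₁≤suc i) (inject₁≤suc j)
                                      (isM (inject₁ i) (suc j)) (isM (suc i) (inject₁ j))
                                      (isM (inject₁ i) (inject₁ j)) (isM (suc i) (suc j))) ⟩
    0ℤ                ∎
    where
    open ℤ.≤-Reasoning
    A B C D : ℤ
    A = M (inject₁ i) (suc j)
    B = M (suc i) (inject₁ j)
    C = M (inject₁ i) (inject₁ j)
    D = M (suc i) (suc j)

  entry≤n : ∀ i j → M i j ℤ.≤ + n
  entry≤n i j = begin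
    M i j         ≡⟨ sym (+-identityʳ (M i j)) ⟩
    M i j + 0ℤ    ≤⟨ walk-weight≤rise (proj₁ (isM i j)) ⟩
    + len* s      ≤⟨ +≤+ (len*≤ s) ⟩
    + n           ∎
    where open ℤ.≤-Reasoning

  first-row-nonnegative : ∀ j → 0ℤ ℤ.≤ M zero j
  first-row-nonnegative j = proj₂ (isM zero j) _ (rightward j≤n ++ upward j≤n ≤-refl)
    where
    j≤n : toℕ j ≤ n
    j≤n = toℕ≤pred[n] j

  first-column≥-2i : ∀ i → -[1+ 1 ] ℤ.* + toℕ i ℤ.≤ M i zero
  first-column≥-2i i = begin
    -[1+ 1 ] ℤ.* + toℕ i        ≡⟨ sym (+-identityʳ _) ⟩
    -[1+ 1 ] ℤ.* + toℕ i + 0ℤ   ≤⟨ proj₂ (isM i zero) _ (leftward i≤n ++ upward z≤n ≤-refl) ⟩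
    M i zero                    ∎
    where
    open ℤ.≤-Reasoning
    i≤n : toℕ i ≤ n
    i≤n = toℕ≤pred[n] i

  corner-difference≤4n : (M (fromℕ n) (fromℕ n) - M (fromℕ n) zero) - (M zero (fromℕ n) - M zero zero) ℤ.≤ + (4 * n)
  corner-difference≤4n = corner-difference≤ (entry≤n _ _) (entry≤n _ _) (first-row-nonnegative _)
    (subst (λ k → -[1+ 1 ] ℤ.* + k ℤ.≤ M (fromℕ n) zero) (toℕ-fromℕ n) (first-column≥-2i (fromℕ n)))

corollary5p9 : ∃[ C ] ∃[ N ] (∀ (n : ℕ) → N ≤ n → (s : Vec (Maybe ℕ) n) → IsSubperm s →
                 (M : Fin (suc n) → Fin (suc n) → ℤ) → IsAlignMatrix s M → δ M ≤ C * n)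
corollary5p9 = 4 , 0 , λ n _ s _ M isM → ℤ.drop‿+≤+ (begin
  + δ M                                        ≤⟨ δ≤∑∑-neg-box M (box-nonpositive isM) ⟩
  ∑[ i < n ] ∑[ j < n ] (- box M i j)          ≡⟨ ∑∑-neg-box M ⟩
  (M (fromℕ n) (fromℕ n) - M (fromℕ n) zero)
    - (M zero (fromℕ n) - M zero zero)         ≤⟨ corner-difference≤4n isM ⟩
  + (4 * n)                                    ∎)
  where open ℤ.≤-Reasoning
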